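{- Let $Q=\langle x,y : x^4=y^4=1,\ yxy^{ -1}=x^{ -1},\ x^2=y^2\rangle$ be the quaternion group of order $8$, and let $G$ be a group of order $16$ containing a subgroup isomorphic to $Q$. Then $G\in\mathcal{H}$, i.e. $G$ contains a Hadamard difference set.
   Context: For a finite group $G$ and $A=\sum a_g g\in\mathbb{Z}G$, $A^{(-1)}=\sum a_g g^{ -1}$. A Hadamard difference set in $G$ is a subset $D$ whose $\{\pm1\}$-valued characteristic function ($-1$ on $D$, $+1$ off $D$), viewed in $\mathbb{Z}G$, satisfies $DD^{(-1)}=|G|$; $\mathcal{H}$ is the class of groups containing a Hadamard difference set. -}

module Defs where

open import Level using (Level)
open import Data.Bool using (Bool; true; false; if_then_else_)
open import Data.Nat using (ℕ; _+_; _*_)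
open import Data.Nat.DivMod using (_mod_)
open import Data.Fin using (Fin; toℕ)
import Data.Fin as Fin
open import Data.Fin.Subset using (Subset; _∈_)
open import Data.Fin.Subset.Properties using (_∈?_)
open import Data.Integer using (ℤ; +_; -[1+_]; 0ℤ) renaming (_+_ to _+ℤ_; _*_ to _*ℤ_)
open import Data.Product using (_×_; _,_; Σ; ∃)
open import Relation.Nullary using (¬_; yes; no)
open import Relation.Binary.PropositionalEquality using (_≡_)
import Relation.Binary.PropositionalEquality as ≡
open import Algebra.Bundles using (Group)
open import Function.Bundles using (Inverse)

-- The quaternion group Q = ⟨x,y : x⁴=y⁴=1, yxy⁻¹=x⁻¹, x²=y²⟩ of order 8,
-- modelled concretely: every element is uniquely x^a y^b with
-- a ∈ {0,1,2,3}, b ∈ {0,1}; the pair (a , b) represents x^a y^b.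
-- Multiplication:  x^a y^b · x^c y^d = x^(a + (-1)^b c) y^(b+d),
-- and y² = x² is used to reduce y^(b+d) when b = d = 1.

Q : Set
Q = Fin 4 × Bool

infixl 7 _·Q_
_·Q_ : Q → Q → Q
(a , false) ·Q (c , false) = (toℕ a + toℕ c) mod 4 , false
(a , false) ·Q (c , true)  = (toℕ a + toℕ c) mod 4 , true
(a , true)  ·Q (c , false) = (toℕ a + 3 * toℕ c) mod 4 , true
(a , true)  ·Q (c , true)  = (toℕ a + 3 * toℕ c + 2) mod 4 , false

-- G contains a subgroup isomorphic to Q: there is an injective group
-- homomorphism Q → G (its image is then a subgroup isomorphic to Q).
record QuaternionSubgroup {c ℓ : Level} (G : Group c ℓ) : Set (c Level.⊔ ℓ) where
  open Group G
  field
    embed      : Q → Carrier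
    embed-hom  : ∀ p q → embed (p ·Q q) ≈ embed p ∙ embed q
    embed-inj  : ∀ p q → embed p ≈ embed q → p ≡ q

∑ : ∀ {n} → (Fin n → ℤ) → ℤ
∑ {ℕ.zero}  f = 0ℤ
∑ {ℕ.suc n} f = f Fin.zero +ℤ ∑ (λ i → f (Fin.suc i))

Enumeration : ∀ {c ℓ} → Group c ℓ → ℕ → Set _
Enumeration G n = Inverse (Group.setoid G) (≡.setoid (Fin n))

module _ {c ℓ} (G : Group c ℓ) {n : ℕ} (e : Enumeration G n) where
  open Group G
  open Inverse e

  χ : Subset n → Carrier → ℤ
  χ D g with to g ∈? D
  ... | yes _ = -[1+ 0 ]
  ... | no  _ = + 1

  -- Coefficient of g in D D^(-1) ∈ ℤG, where D = Σ_h χ(h) h: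
  -- (D D^(-1))_g = Σ_{h k⁻¹ = g} χ(h) χ(k) = Σ_h χ(h) χ(g⁻¹ h).
  coeffDD⁻¹ : Subset n → Carrier → ℤ
  coeffDD⁻¹ D g = ∑ (λ i → χ D (from i) *ℤ χ D (g ⁻¹ ∙ from i))

  IsHadamardDS : Subset n → Set (c Level.⊔ ℓ)
  IsHadamardDS D =
    (∀ g → g ≈ ε → coeffDD⁻¹ D g ≡ + n) × (∀ g → ¬ (g ≈ ε) → coeffDD⁻¹ D g ≡ 0ℤ)

InH : ∀ {c ℓ} (G : Group c ℓ) {n : ℕ} → Enumeration G n → Set (c Level.⊔ ℓ)
InH G e = ∃ λ D → IsHadamardDS G e D

-- Q has index 2 in G, so G = Q ∪ Q t for any t ∉ Q.  Conjugation by t is an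
-- automorphism φ of Q and t² = c lies in Q, so G is the extension of Q described
-- by (φ , c).  A fixed set D = A ∪ B t (A, B ⊆ Q) is a Hadamard difference set
-- in every such extension: φ is determined by the images of x and y, so this is
-- a finite computation over the pairs (φ , c).  Transporting D along Q × {1, t} ≅ G
-- gives the difference set in G.
module Submission where

open import Defs
open import Level using (Level)
open import Algebra.Bundles using (Group)

import Algebra.Properties.CommutativeMonoid.Sum as CommutativeMonoidSum
import Algebra.Properties.Group as GroupProperties
open import Data.Bool using (Bool; true; false)
import Data.Bool.Properties as Bool
open import Data.Empty using (⊥-elim)
open import Data.Fin using (Fin; toℕ; zero; suc)
open import Data.Fin.Patterns using (0F; 1F; 2F; 3F)
open import Data.Fin.Permutation using (Permutation′; permutation; _⟨$⟩ʳ_)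
import Data.Fin.Properties as Fin
open import Data.Fin.Subset using (Subset)
open import Data.Fin.Subset.Properties using (_∈?_)
open import Data.Integer using (ℤ; +_; -[1+_]; 0ℤ) renaming (_+_ to _+ℤ_; _*_ to _*ℤ_)
import Data.Integer.Properties as ℤ
open import Data.Nat using (ℕ; _≤_; _<_)
import Data.Nat.Properties as ℕ
open import Data.Product using (_×_; _,_; proj₁; proj₂; ∃)
open import Data.Product.Function.NonDependent.Propositional using (_×-↔_)
open import Data.Product.Properties using (≡-dec)
open import Data.Vec using (lookup; tabulate)
open import Data.Vec.Properties using (lookup∘tabulate; []=⇒lookup; lookup⇒[]=)
open import Function.Base using (_∘_)
open import Function.Bundles using (Inverse; _↔_)
open import Function.Definitions using (Injective)
open import Function.Properties.Inverse using (↔-refl; ↔-sym; ↔-trans)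
open import Relation.Binary.Bundles using (Setoid)
open import Relation.Binary.Definitions using (DecidableEquality)
import Relation.Binary.PropositionalEquality as ≡
open ≡ using (_≡_; _≢_; refl; cong)
import Relation.Binary.Reasoning.Setoid as SetoidReasoning
open import Relation.Nullary using (¬_; Dec; yes; no; contradiction)
open import Relation.Nullary.Decidable using (map′; from-yes; ¬?; _→-dec_)
open import Relation.Unary using (Pred; Decidable)

∑-cong : ∀ {n} {f g : Fin n → ℤ} → (∀ i → f i ≡ g i) → ∑ f ≡ ∑ g
∑-cong {ℕ.zero}  f≗g = refl
∑-cong {ℕ.suc n} f≗g = ≡.cong₂ _+ℤ_ (f≗g zero) (∑-cong (f≗g ∘ suc))

module ℤSum = CommutativeMonoidSum ℤ.+-0-commutativeMonoid

∑≡sum : ∀ {n} (f : Fin n → ℤ) → ∑ f ≡ ℤSum.sum f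
∑≡sum {ℕ.zero}  f = refl
∑≡sum {ℕ.suc n} f = cong (f zero +ℤ_) (∑≡sum (f ∘ suc))

∑-permute : ∀ {n} (f : Fin n → ℤ) (π : Permutation′ n) → ∑ f ≡ ∑ (f ∘ (π ⟨$⟩ʳ_))
∑-permute f π = begin
  ∑ f                      ≡⟨ ∑≡sum f ⟩
  ℤSum.sum f               ≡⟨ ℤSum.sum-permute f π ⟩
  ℤSum.sum (f ∘ (π ⟨$⟩ʳ_)) ≡⟨ ∑≡sum (f ∘ (π ⟨$⟩ʳ_)) ⟨
  ∑ (f ∘ (π ⟨$⟩ʳ_))        ∎
  where open ≡.≡-Reasoning

all?-↔ : ∀ {a p n} {A : Set a} {P : Pred A p} → A ↔ Fin n → Decidable P → Dec (∀ x → P x)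
all?-↔ {P = P} A↔Fin P? =
  map′ (λ h x → ≡.subst P (strictlyInverseʳ x) (h (to x))) (λ h → h ∘ from) (Fin.all? (P? ∘ from))
  where open Inverse A↔Fin

module FiniteSetoid {c ℓ} {S : Setoid c ℓ} {n : ℕ} (enum : Inverse S (≡.setoid (Fin n))) where
  open Setoid S using (Carrier; _≈_; sym; trans)
  open Inverse enum
  open SetoidReasoning S

  to-injective : Injective _≈_ _≡_ to
  to-injective {x} {y} eq = begin
    x           ≈⟨ strictlyInverseʳ x ⟨
    from (to x) ≡⟨ cong from eq ⟩
    from (to y) ≈⟨ strictlyInverseʳ y ⟩
    y           ∎

  from-injective : Injective _≡_ _≈_ from
  from-injective {i} {j} eq = ≡.trans (≡.sym (strictlyInverseˡ i)) (≡.trans (to-cong eq) (strictlyInverseˡ j))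

  infix 4 _≟_
  _≟_ : ∀ x y → Dec (x ≈ y)
  x ≟ y = map′ to-injective to-cong (to x Fin.≟ to y)

  covers⇒≤ : ∀ {m} (f : Fin m → Carrier) → (∀ x → ∃ λ i → x ≈ f i) → n ≤ m
  covers⇒≤ f cover = Fin.injective⇒≤ pick-injective
    where
    pick : Fin n → Fin _
    pick = proj₁ ∘ cover ∘ from
    pick-injective : Injective _≡_ _≡_ pick
    pick-injective {i} {j} eq = from-injective (begin
      from i       ≈⟨ proj₂ (cover (from i)) ⟩
      f (pick i)   ≡⟨ cong f eq ⟩
      f (pick j)   ≈⟨ proj₂ (cover (from j)) ⟨
      from j       ∎)

  injective⇒covers : (f : Fin n → Carrier) → Injective _≡_ _≈_ f → ∀ x → ∃ λ i → x ≈ f i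
  injective⇒covers f f-injective x with Fin.any? (λ i → x ≟ f i)
  ... | yes found = found
  ... | no  x∉f   = contradiction (Fin.injective⇒≤ extend-injective) ℕ.1+n≰n
    where
    extend : Fin (ℕ.suc n) → Fin n
    extend zero    = to x
    extend (suc i) = to (f i)
    extend-injective : Injective _≡_ _≡_ extend
    extend-injective {zero}  {zero}  _  = refl
    extend-injective {zero}  {suc j} eq = ⊥-elim (x∉f (j , to-injective eq))
    extend-injective {suc i} {zero}  eq = ⊥-elim (x∉f (i , sym (to-injective eq)))
    extend-injective {suc i} {suc j} eq = cong suc (f-injective (to-injective eq))

  uncovered : ∀ {m} → m < n → (f : Fin m → Carrier) → ∃ λ x → ∀ i → ¬ x ≈ f i
  uncovered {m} m<n f = from (proj₁ witness) , λ i eq → proj₂ witness (i , eq)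
    where
    ¬covers : ¬ (∀ j → ∃ λ i → from j ≈ f i)
    ¬covers cover = ℕ.<⇒≱ m<n (covers⇒≤ f λ x →
      proj₁ (cover (to x)) , trans (sym (strictlyInverseʳ x)) (proj₂ (cover (to x))))
    witness : ∃ λ j → ¬ ∃ λ i → from j ≈ f i
    witness = Fin.¬∀⟶∃¬ n _ (λ j → Fin.any? (λ i → from j ≟ f i)) ¬covers

  ∑-reindex : (f : Fin n → Carrier) → Injective _≡_ _≈_ f →
    (F : Carrier → ℤ) → (∀ {x y} → x ≈ y → F x ≡ F y) → ∑ (F ∘ from) ≡ ∑ (F ∘ f)
  ∑-reindex f f-injective F F-cong = ≡.trans (∑-permute (F ∘ from) π)
    (∑-cong λ i → F-cong (strictlyInverseʳ (f i)))
    where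
    preimage : Fin n → Fin n
    preimage j = proj₁ (injective⇒covers f f-injective (from j))
    preimage-spec : ∀ j → from j ≈ f (preimage j)
    preimage-spec j = proj₂ (injective⇒covers f f-injective (from j))
    π : Permutation′ n
    π = permutation (to ∘ f) preimage
      (λ j → ≡.trans (to-cong (sym (preimage-spec j))) (strictlyInverseˡ j))
      (λ i → f-injective (trans (sym (preimage-spec (to (f i)))) (strictlyInverseʳ (f i))))

sgn : Bool → ℤ
sgn true  = -[1+ 0 ]
sgn false = + 1

module Characteristic {c ℓ} (G : Group c ℓ) {n : ℕ} (enum : Enumeration G n) where
  open Group G using (Carrier; _≈_)
  open Inverse enum

  χ≡sgn∘lookup : ∀ D g → χ G enum D g ≡ sgn (lookup D (to g))
  χ≡sgn∘lookup D g with to g ∈? D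
  ... | yes g∈D = cong sgn (≡.sym ([]=⇒lookup g∈D))
  ... | no  g∉D with lookup D (to g) in eq
  ...   | true  = ⊥-elim (g∉D (lookup⇒[]= (to g) D eq))
  ...   | false = refl

  χ-cong : ∀ D {x y} → x ≈ y → χ G enum D x ≡ χ G enum D y
  χ-cong D {x} {y} x≈y = begin
    χ G enum D x            ≡⟨ χ≡sgn∘lookup D x ⟩
    sgn (lookup D (to x))   ≡⟨ cong (sgn ∘ lookup D) (to-cong x≈y) ⟩
    sgn (lookup D (to y))   ≡⟨ χ≡sgn∘lookup D y ⟨
    χ G enum D y            ∎
    where open ≡.≡-Reasoning

  χ²≡1 : ∀ D x → χ G enum D x *ℤ χ G enum D x ≡ + 1
  χ²≡1 D x rewrite χ≡sgn∘lookup D x with lookup D (to x)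
  ... | true  = refl
  ... | false = refl

  χ-tabulate : ∀ (P : Carrier → Bool) g → χ G enum (tabulate (P ∘ from)) g ≡ sgn (P (from (to g)))
  χ-tabulate P g = ≡.trans (χ≡sgn∘lookup _ g) (cong sgn (lookup∘tabulate (P ∘ from) (to g)))

infix 4 _≟Q_
_≟Q_ : DecidableEquality Q
_≟Q_ = ≡-dec Fin._≟_ Bool._≟_

Q↔Fin8 : Q ↔ Fin 8
Q↔Fin8 = ↔-trans (↔-refl ×-↔ ↔-sym Fin.2↔Bool) (↔-sym (Fin.*↔× {4} {2}))

∀Q? : ∀ {p} {P : Pred Q p} → Decidable P → Dec (∀ q → P q)
∀Q? = all?-↔ Q↔Fin8

eQ xQ yQ : Q
eQ = 0F , false
xQ = 1F , false
yQ = 0F , true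

infixl 8 _^Q_
_^Q_ : Q → ℕ → Q
q ^Q ℕ.zero  = eQ
q ^Q ℕ.suc k = q ^Q k ·Q q

^Q4≡eQ : ∀ q → q ^Q 4 ≡ eQ
^Q4≡eQ = from-yes (∀Q? λ q → q ^Q 4 ≟Q eQ)

idempotent⇒eQ : ∀ q → q ·Q q ≡ q → q ≡ eQ
idempotent⇒eQ = from-yes (∀Q? λ q → (q ·Q q ≟Q q) →-dec (q ≟Q eQ))

fromGenerators : Q → Q → Q → Q
fromGenerators u v (a , false) = u ^Q toℕ a
fromGenerators u v (a , true)  = u ^Q toℕ a ·Q v

fromGenerators-x-y : ∀ q → fromGenerators xQ yQ q ≡ q
fromGenerators-x-y = from-yes (∀Q? λ q → fromGenerators xQ yQ q ≟Q q)

hom⇒≗fromGenerators : ∀ (φ : Q → Q) → (∀ p q → φ (p ·Q q) ≡ φ p ·Q φ q) →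
  ∀ q → φ q ≡ fromGenerators (φ xQ) (φ yQ) q
hom⇒≗fromGenerators φ φ-hom q = begin
  φ q                                         ≡⟨ cong φ (fromGenerators-x-y q) ⟨
  φ (fromGenerators xQ yQ q)                  ≡⟨ φ-fromGenerators q ⟩
  fromGenerators (φ xQ) (φ yQ) q              ∎
  where
  open ≡.≡-Reasoning
  φ-eQ : φ eQ ≡ eQ
  φ-eQ = idempotent⇒eQ (φ eQ) (≡.sym (φ-hom eQ eQ))
  φ-^ : ∀ k → φ (xQ ^Q k) ≡ φ xQ ^Q k
  φ-^ ℕ.zero    = φ-eQ
  φ-^ (ℕ.suc k) = ≡.trans (φ-hom (xQ ^Q k) xQ) (cong (_·Q φ xQ) (φ-^ k))
  φ-fromGenerators : ∀ q → φ (fromGenerators xQ yQ q) ≡ fromGenerators (φ xQ) (φ yQ) q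
  φ-fromGenerators (a , false) = φ-^ (toℕ a)
  φ-fromGenerators (a , true)  = ≡.trans (φ-hom _ yQ) (cong (_·Q φ yQ) (φ-^ (toℕ a)))

-- (q , b) stands for q tᵇ in a group Q ∪ Q t, where t q = φ(q) t and t² = c.
M : Set
M = Q × Bool

eM : M
eM = eQ , false

infix 4 _≟M_
_≟M_ : DecidableEquality M
_≟M_ = ≡-dec _≟Q_ Bool._≟_

M↔Fin16 : M ↔ Fin 16
M↔Fin16 = ↔-trans (Q↔Fin8 ×-↔ ↔-sym Fin.2↔Bool) (↔-sym (Fin.*↔× {8} {2}))

decodeM : Fin 16 → M
decodeM = Inverse.from M↔Fin16

decodeM-injective : Injective _≡_ _≡_ decodeM
decodeM-injective = FiniteSetoid.from-injective M↔Fin16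

∀M? : ∀ {p} {P : Pred M p} → Decidable P → Dec (∀ m → P m)
∀M? = all?-↔ M↔Fin16

twistedMul : (Q → Q) → Q → M → M → M
twistedMul φ c (p , false) (q , b)     = p ·Q q , b
twistedMul φ c (p , true)  (q , false) = p ·Q φ q , true
twistedMul φ c (p , true)  (q , true)  = p ·Q φ q ·Q c , false

twistedMul-cong : ∀ {φ ψ} → (∀ q → φ q ≡ ψ q) → ∀ c w m → twistedMul φ c w m ≡ twistedMul ψ c w m
twistedMul-cong φ≗ψ c (p , false) m           = refl
twistedMul-cong φ≗ψ c (p , true)  (q , false) = cong (λ r → p ·Q r , true) (φ≗ψ q)
twistedMul-cong φ≗ψ c (p , true)  (q , true)  = cong (λ r → p ·Q r ·Q c , false) (φ≗ψ q)

-- D = A ∪ B t with A = Q ∖ {1, x³, x²y, x³y} and B = Q ∖ {xy, x³y}.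
inD : M → Bool
inD ((0F , false) , false) = false
inD ((3F , false) , false) = false
inD ((2F , true)  , false) = false
inD ((3F , true)  , false) = false
inD ((1F , true)  , true)  = false
inD ((3F , true)  , true)  = false
inD _                      = true

χM : M → ℤ
χM = sgn ∘ inD

twistedAutocorrelation : (Q → Q) → Q → M → ℤ
twistedAutocorrelation φ c w = ∑ λ j → χM (decodeM j) *ℤ χM (twistedMul φ c w (decodeM j))

twistedAutocorrelation≡0 : ∀ u v → Injective _≡_ _≡_ (fromGenerators u v) →
  ∀ c w → w ≢ eM → twistedAutocorrelation (fromGenerators u v) c w ≡ 0ℤ
twistedAutocorrelation≡0 = from-yes
  (∀Q? λ u → ∀Q? λ v → injective? u v →-dec
    (∀Q? λ c → ∀M? λ w → ¬? (w ≟M eM) →-dec (twistedAutocorrelation (fromGenerators u v) c w ℤ.≟ 0ℤ)))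
  where
  injective? : ∀ u v → Dec (Injective _≡_ _≡_ (fromGenerators u v))
  injective? u v = map′ (λ h {p} {q} → h p q) (λ h p q → h)
    (∀Q? λ p → ∀Q? λ q → (fromGenerators u v p ≟Q fromGenerators u v q) →-dec (p ≟Q q))

module IndexTwo {g ℓ} (G : Group g ℓ) (enum : Enumeration G 16) (H : QuaternionSubgroup G) where
  open Group G renaming (refl to ≈-refl)
  open QuaternionSubgroup H
  open GroupProperties G using (identityˡ-unique; inverseˡ-unique; y≈x\\z; x≈z//y; ∙-cancelʳ; ⁻¹-injective; ε⁻¹≈ε)
  open Inverse enum using (to; from; strictlyInverseʳ)
  open FiniteSetoid enum using (uncovered; injective⇒covers; ∑-reindex)
  open Characteristic G enum
  open SetoidReasoning setoid

  embed-ε : embed eQ ≈ ε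
  embed-ε = identityˡ-unique (embed eQ) (embed eQ) (sym (embed-hom eQ eQ))

  embed-⁻¹ : ∀ q → embed (q ^Q 3) ≈ embed q ⁻¹
  embed-⁻¹ q = inverseˡ-unique (embed (q ^Q 3)) (embed q) (begin
    embed (q ^Q 3) ∙ embed q ≈⟨ embed-hom (q ^Q 3) q ⟨
    embed (q ^Q 4)           ≡⟨ cong embed (^Q4≡eQ q) ⟩
    embed eQ                 ≈⟨ embed-ε ⟩
    ε                        ∎)

  embed-\\ : ∀ p q → embed p \\ embed q ≈ embed (p ^Q 3 ·Q q)
  embed-\\ p q = trans (∙-congʳ (sym (embed-⁻¹ p))) (sym (embed-hom (p ^Q 3) q))

  embed-// : ∀ p q → embed p // embed q ≈ embed (p ·Q q ^Q 3)
  embed-// p q = trans (∙-congˡ (sym (embed-⁻¹ q))) (sym (embed-hom p (q ^Q 3)))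

  outsider : ∃ λ t → ∀ q → ¬ t ≈ embed q
  outsider = proj₁ uncoveredByQ , λ q t≈q → proj₂ uncoveredByQ (Inverse.to Q↔Fin8 q)
    (trans t≈q (reflexive (cong embed (≡.sym (Inverse.strictlyInverseʳ Q↔Fin8 q)))))
    where
    uncoveredByQ : ∃ λ t → ∀ i → ¬ t ≈ embed (Inverse.from Q↔Fin8 i)
    uncoveredByQ = uncovered (from-yes (8 ℕ.<? 16)) (embed ∘ Inverse.from Q↔Fin8)

  t : Carrier
  t = proj₁ outsider

  t∉Q : ∀ q → ¬ t ≈ embed q
  t∉Q = proj₂ outsider

  coset : M → Carrier
  coset (q , false) = embed q
  coset (q , true)  = embed q ∙ t

  Q∩Qt≡∅ : ∀ p q → ¬ embed p ≈ embed q ∙ t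
  Q∩Qt≡∅ p q p≈qt = t∉Q (q ^Q 3 ·Q p) (trans (y≈x\\z (embed q) t (embed p) (sym p≈qt)) (embed-\\ q p))

  coset-injective : Injective _≡_ _≈_ coset
  coset-injective {p , false} {q , false} eq = cong (_, false) (embed-inj p q eq)
  coset-injective {p , false} {q , true}  eq = ⊥-elim (Q∩Qt≡∅ p q eq)
  coset-injective {p , true}  {q , false} eq = ⊥-elim (Q∩Qt≡∅ q p (sym eq))
  coset-injective {p , true}  {q , true}  eq = cong (_, true) (embed-inj p q (∙-cancelʳ t (embed p) (embed q) eq))

  coset∘decodeM-injective : Injective _≡_ _≈_ (coset ∘ decodeM)
  coset∘decodeM-injective = decodeM-injective ∘ coset-injective

  decompose : ∀ x → ∃ λ m → x ≈ coset m
  decompose x = decodeM (proj₁ covering) , proj₂ covering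
    where
    covering : ∃ λ i → x ≈ coset (decodeM i)
    covering = injective⇒covers (coset ∘ decodeM) coset∘decodeM-injective x

  conjugate : ∀ q → ∃ λ r → t ∙ embed q ≈ embed r ∙ t
  conjugate q = inUpperCoset (decompose (t ∙ embed q))
    where
    inUpperCoset : (∃ λ m → t ∙ embed q ≈ coset m) → ∃ λ r → t ∙ embed q ≈ embed r ∙ t
    inUpperCoset ((r , true)  , tq≈rt) = r , tq≈rt
    inUpperCoset ((r , false) , tq≈r)  =
      ⊥-elim (t∉Q (r ·Q q ^Q 3) (trans (x≈z//y t (embed q) (embed r) tq≈r) (embed-// r q)))

  square : ∃ λ c → t ∙ t ≈ embed c
  square = inLowerCoset (decompose (t ∙ t))
    where
    inLowerCoset : (∃ λ m → t ∙ t ≈ coset m) → ∃ λ c → t ∙ t ≈ embed c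
    inLowerCoset ((r , false) , tt≈r)  = r , tt≈r
    inLowerCoset ((r , true)  , tt≈rt) = ⊥-elim (t∉Q r (∙-cancelʳ t t (embed r) tt≈rt))

  φ : Q → Q
  φ = proj₁ ∘ conjugate

  φ-spec : ∀ q → t ∙ embed q ≈ embed (φ q) ∙ t
  φ-spec = proj₂ ∘ conjugate

  c : Q
  c = proj₁ square

  coset-hom : ∀ m n → coset m ∙ coset n ≈ coset (twistedMul φ c m n)
  coset-hom (p , false) (q , false) = sym (embed-hom p q)
  coset-hom (p , false) (q , true)  = trans (sym (assoc _ _ _)) (∙-congʳ (sym (embed-hom p q)))
  coset-hom (p , true)  (q , false) = begin
    (embed p ∙ t) ∙ embed q       ≈⟨ assoc _ _ _ ⟩
    embed p ∙ (t ∙ embed q)       ≈⟨ ∙-congˡ (φ-spec q) ⟩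
    embed p ∙ (embed (φ q) ∙ t)   ≈⟨ assoc _ _ _ ⟨
    (embed p ∙ embed (φ q)) ∙ t   ≈⟨ ∙-congʳ (embed-hom p (φ q)) ⟨
    embed (p ·Q φ q) ∙ t          ∎
  coset-hom (p , true)  (q , true)  = begin
    (embed p ∙ t) ∙ (embed q ∙ t) ≈⟨ assoc _ _ _ ⟨
    ((embed p ∙ t) ∙ embed q) ∙ t ≈⟨ ∙-congʳ (coset-hom (p , true) (q , false)) ⟩
    (embed (p ·Q φ q) ∙ t) ∙ t    ≈⟨ assoc _ _ _ ⟩
    embed (p ·Q φ q) ∙ (t ∙ t)    ≈⟨ ∙-congˡ (proj₂ square) ⟩
    embed (p ·Q φ q) ∙ embed c    ≈⟨ embed-hom (p ·Q φ q) c ⟨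
    embed (p ·Q φ q ·Q c)         ∎

  φ-hom : ∀ p q → φ (p ·Q q) ≡ φ p ·Q φ q
  φ-hom p q = cong proj₁ (coset-injective {φ (p ·Q q) , true} {φ p ·Q φ q , true} (begin
    embed (φ (p ·Q q)) ∙ t           ≈⟨ φ-spec (p ·Q q) ⟨
    t ∙ embed (p ·Q q)               ≈⟨ ∙-congˡ (embed-hom p q) ⟩
    t ∙ (embed p ∙ embed q)          ≈⟨ assoc _ _ _ ⟨
    (t ∙ embed p) ∙ embed q          ≈⟨ ∙-congʳ (φ-spec p) ⟩
    (embed (φ p) ∙ t) ∙ embed q      ≈⟨ coset-hom (φ p , true) (q , false) ⟩
    embed (φ p ·Q φ q) ∙ t           ∎))

  φ-injective : Injective _≡_ _≡_ φ
  φ-injective {p} {q} φp≡φq = embed-inj p q (∙-cancelˡ t (embed p) (embed q) (begin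
    t ∙ embed p       ≈⟨ φ-spec p ⟩
    embed (φ p) ∙ t   ≡⟨ cong (λ r → embed r ∙ t) φp≡φq ⟩
    embed (φ q) ∙ t   ≈⟨ φ-spec q ⟨
    t ∙ embed q       ∎))
    where open GroupProperties G using (∙-cancelˡ)

  φ≗fromGenerators : ∀ q → φ q ≡ fromGenerators (φ xQ) (φ yQ) q
  φ≗fromGenerators = hom⇒≗fromGenerators φ φ-hom

  fromGenerators-φ-injective : Injective _≡_ _≡_ (fromGenerators (φ xQ) (φ yQ))
  fromGenerators-φ-injective {p} {q} eq =
    φ-injective (≡.trans (φ≗fromGenerators p) (≡.trans eq (≡.sym (φ≗fromGenerators q))))

  D : Subset 16
  D = tabulate (inD ∘ proj₁ ∘ decompose ∘ from)

  χD-coset : ∀ {x} m → x ≈ coset m → χ G enum D x ≡ χM m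
  χD-coset {x} m x≈m = ≡.trans (χ-tabulate (inD ∘ proj₁ ∘ decompose) x)
    (cong (sgn ∘ inD) (coset-injective (begin
      coset (proj₁ (decompose (from (to x)))) ≈⟨ proj₂ (decompose (from (to x))) ⟨
      from (to x)                             ≈⟨ strictlyInverseʳ x ⟩
      x                                       ≈⟨ x≈m ⟩
      coset m                                 ∎)))

  coeffDD⁻¹-ε : ∀ x → x ≈ ε → coeffDD⁻¹ G enum D x ≡ + 16
  coeffDD⁻¹-ε x x≈ε = ∑-cong λ i → ≡.trans (cong (χ G enum D (from i) *ℤ_) (χ-cong D (x⁻¹y≈y (from i))))
                                        (χ²≡1 D (from i))
    where
    x⁻¹y≈y : ∀ y → x ⁻¹ ∙ y ≈ y
    x⁻¹y≈y y = trans (∙-congʳ (trans (⁻¹-cong x≈ε) ε⁻¹≈ε)) (identityˡ y)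

  coeffDD⁻¹-≉ε : ∀ x → ¬ x ≈ ε → coeffDD⁻¹ G enum D x ≡ 0ℤ
  coeffDD⁻¹-≉ε x x≉ε = ≡.trans (∑-reindex (coset ∘ decodeM) coset∘decodeM-injective F F-cong)
    (≡.trans (∑-cong (termwise ∘ decodeM)) (twistedAutocorrelation≡0 (φ xQ) (φ yQ) fromGenerators-φ-injective c w w≢eM))
    where
    F : Carrier → ℤ
    F y = χ G enum D y *ℤ χ G enum D (x ⁻¹ ∙ y)
    F-cong : ∀ {y z} → y ≈ z → F y ≡ F z
    F-cong y≈z = ≡.cong₂ _*ℤ_ (χ-cong D y≈z) (χ-cong D (∙-congˡ y≈z))
    ψ : Q → Q
    ψ = fromGenerators (φ xQ) (φ yQ)
    w : M
    w = proj₁ (decompose (x ⁻¹))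
    x⁻¹m≈wm : ∀ m → x ⁻¹ ∙ coset m ≈ coset (twistedMul ψ c w m)
    x⁻¹m≈wm m = begin
      x ⁻¹ ∙ coset m              ≈⟨ ∙-congʳ (proj₂ (decompose (x ⁻¹))) ⟩
      coset w ∙ coset m           ≈⟨ coset-hom w m ⟩
      coset (twistedMul φ c w m)  ≡⟨ cong coset (twistedMul-cong φ≗fromGenerators c w m) ⟩
      coset (twistedMul ψ c w m)  ∎
    termwise : ∀ m → F (coset m) ≡ χM m *ℤ χM (twistedMul ψ c w m)
    termwise m = ≡.cong₂ _*ℤ_ (χD-coset m ≈-refl) (χD-coset (twistedMul ψ c w m) (x⁻¹m≈wm m))
    w≢eM : w ≢ eM
    w≢eM w≡eM = x≉ε (⁻¹-injective (begin
      x ⁻¹        ≈⟨ proj₂ (decompose (x ⁻¹)) ⟩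
      coset w     ≡⟨ cong coset w≡eM ⟩
      embed eQ    ≈⟨ embed-ε ⟩
      ε           ≈⟨ ε⁻¹≈ε ⟨
      ε ⁻¹        ∎))

proposition4p1 : {c ℓ : Level} (G : Group c ℓ) (e : Enumeration G 16) →
    QuaternionSubgroup G → InH G e
proposition4p1 G e H = D , coeffDD⁻¹-ε , coeffDD⁻¹-≉ε
  where open IndexTwo G e H
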